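{- Let $r,s,k_0,k_1$ be non-negative integers with $k_0\le r$ and $k_1\le s$. Then $$N_{2\times 8}(r,s;k_0,k_1,0,0)=N_{2\times 8}(r,s;r-k_0,s-k_1,0,0),$$ i.e. the number of $\mathbb{Z}_2\mathbb{Z}_8$-additive codes of type $(r,s;k_0,k_1,0,0)$ equals the number of codes of the type of their duals.
   Context: For non-negative integers $\alpha,\beta,k_0,k_1,k_2,k_3$, $N_{2\times 8}(\alpha,\beta;k_0,k_1,k_2,k_3)=\frac{N_1N_2N_3N_4}{D_1D_2D_3D_4}$ with $N_1=\prod_{i=0}^{k_0-1}((2^{\alpha}-2^{i})2^{\beta})$, $N_2=\prod_{i=0}^{k_1-1}((8^{\beta}-4^{\beta}2^{i})2^{\alpha})$, $N_3=\prod_{i=0}^{k_2-1}((4^{\beta}-2^{\beta+k_1+i})2^{\alpha})$, $N_4=\prod_{i=0}^{k_3-1}(2^{\beta}-2^{k_1+k_2+i})$, $D_1=\prod_{i=0}^{k_0-1}(2^{k_0+k_1+k_2+k_3}-2^{k_1+k_2+k_3+i})$, $D_2=\prod_{i=0}^{k_1-1}((8^{k_1}-4^{k_1}2^{i})2^{k_0+2k_2+k_3})$, $D_3=\prod_{i=0}^{k_2-1}((4^{k_2}-2^{k_2+i})2^{k_0+2k_1+k_3})$, $D_4=\prod_{i=0}^{k_3-1}(2^{k_1+k_2+k_3}-2^{k_1+k_2+i})$; empty products equal $1$. It is the number of $\mathbb{Z}_2\mathbb{Z}_8$-additive codes (subgroups of $\mathbb{Z}_2^\alpha\times\mathbb{Z}_8^\beta$)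 of type $(\alpha,\beta;k_0,k_1,k_2,k_3)$; the dual of a code of type $(\alpha,\beta;k_0,k_1,k_2,k_3)$ has type $(\alpha,\beta;\alpha-k_0,\beta-k_1-k_2-k_3,k_3,k_2)$. -}

module Defs where

import Data.Nat as ℕ
open ℕ using (ℕ; zero; suc; _+_)
open import Data.Integer as ℤ using (ℤ; +_)
open import Data.Rational using (ℚ; 0ℚ; 1ℚ; _*_; _-_; _÷_; _/_; ≢-nonZero)
import Data.Rational.Properties as ℚP
open import Relation.Nullary using (yes; no)

⟦_⟧ : ℕ → ℚ
⟦ n ⟧ = (+ n) / 1

2^ : ℕ → ℚ
2^ n = ⟦ 2 ℕ.^ n ⟧

∏ : ℕ → (ℕ → ℚ) → ℚ
∏ zero    f = 1ℚ
∏ (suc k) f = ∏ k f * f k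

-- total division on ℚ; only ever applied to a nonzero denominator below
-- (all factors of D1..D4 are strictly positive), the 0 branch is unreachable
_÷'_ : ℚ → ℚ → ℚ
p ÷' q with q ℚP.≟ 0ℚ
... | yes _ = 0ℚ
... | no q≢0 = _÷_ p q {{≢-nonZero q≢0}}

N2x8 : ℕ → ℕ → ℕ → ℕ → ℕ → ℕ → ℚ
N2x8 α β k0 k1 k2 k3 = (N1 * N2 * N3 * N4) ÷' (D1 * D2 * D3 * D4)
  where
  N1 = ∏ k0 (λ i → (2^ α - 2^ i) * 2^ β)
  N2 = ∏ k1 (λ i → (2^ (3 ℕ.* β) - 2^ (2 ℕ.* β) * 2^ i) * 2^ α)
  N3 = ∏ k2 (λ i → (2^ (2 ℕ.* β) - 2^ (β + k1 + i)) * 2^ α)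
  N4 = ∏ k3 (λ i → 2^ β - 2^ (k1 + k2 + i))
  D1 = ∏ k0 (λ i → 2^ (k0 + k1 + k2 + k3) - 2^ (k1 + k2 + k3 + i))
  D2 = ∏ k1 (λ i → (2^ (3 ℕ.* k1) - 2^ (2 ℕ.* k1) * 2^ i) * 2^ (k0 + 2 ℕ.* k2 + k3))
  D3 = ∏ k2 (λ i → (2^ (2 ℕ.* k2) - 2^ (k2 + i)) * 2^ (k0 + 2 ℕ.* k1 + k3))
  D4 = ∏ k3 (λ i → 2^ (k1 + k2 + k3) - 2^ (k1 + k2 + i))

-- With k2 = k3 = 0 the formula collapses, for r = k0 + a and s = k1 + b, to
--   N = 2^(b·k0 + 2b·k1 + a·k1) · [k0 + a choose k0]₂ · [k1 + b choose k1]₂ ,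
-- a product of Gaussian binomials.  The exponent is invariant under (k0, k1) ↔ (a, b),
-- and [k + a choose k]₂ = frames(k+a, k+a) / (2^(k·a) · frames(k, k) · frames(a, a)) is
-- symmetric in k and a: split an ordered basis of F₂^(k+a) into its first k and last a vectors.
module Submission where

open import Defs
open import Data.Nat as ℕ using (ℕ; zero; suc; _≤_; _<_; _∸_)
import Data.Nat.Properties as ℕP
import Data.Nat.Solver as ℕSolver
open import Data.Integer as ℤ using (+_)
import Data.Integer.Properties as ℤP
open import Data.Rational using (ℚ; 0ℚ; 1ℚ; _*_; _-_; 1/_; toℚᵘ; ≢-nonZero)
import Data.Rational.Properties as ℚP
import Data.Rational.Solver as ℚSolver
open import Data.Rational.Unnormalised as ℚᵘ using (mkℚᵘ; *≡*)
import Data.Rational.Unnormalised.Properties as ℚᵘP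
open import Algebra.Properties.Group ℚP.+-0-group using (x∙y⁻¹≈ε⇒x≈y)
open import Data.Empty using (⊥-elim)
open import Relation.Nullary using (yes; no)
open import Relation.Binary.PropositionalEquality

⟦⟧≃mkℚᵘ : ∀ m → toℚᵘ ⟦ m ⟧ ℚᵘ.≃ mkℚᵘ (+ m) 0
⟦⟧≃mkℚᵘ m = ℚP.toℚᵘ-fromℚᵘ (mkℚᵘ (+ m) 0)

⟦⟧-* : ∀ m n → ⟦ m ℕ.* n ⟧ ≡ ⟦ m ⟧ * ⟦ n ⟧
⟦⟧-* m n = ℚP.toℚᵘ-injective (begin
  toℚᵘ ⟦ m ℕ.* n ⟧                      ≈⟨ ⟦⟧≃mkℚᵘ (m ℕ.* n) ⟩
  mkℚᵘ (+ (m ℕ.* n)) 0                  ≈⟨ *≡* (cong (ℤ._* + 1) (ℤP.pos-* m n)) ⟩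
  mkℚᵘ (+ m) 0 ℚᵘ.* mkℚᵘ (+ n) 0        ≈⟨ ℚᵘP.*-cong (⟦⟧≃mkℚᵘ m) (⟦⟧≃mkℚᵘ n) ⟨
  toℚᵘ ⟦ m ⟧ ℚᵘ.* toℚᵘ ⟦ n ⟧            ≈⟨ ℚP.toℚᵘ-homo-* ⟦ m ⟧ ⟦ n ⟧ ⟨
  toℚᵘ (⟦ m ⟧ * ⟦ n ⟧)                  ∎)
  where open ℚᵘP.≃-Reasoning

⟦⟧-injective : ∀ {m n} → ⟦ m ⟧ ≡ ⟦ n ⟧ → m ≡ n
⟦⟧-injective {m} {n} eq = ℤP.+-injective (begin
  + m          ≡⟨ ℤP.*-identityʳ (+ m) ⟨
  + m ℤ.* + 1  ≡⟨ ℚᵘP.drop-*≡* toℚᵘ-eq ⟩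
  + n ℤ.* + 1  ≡⟨ ℤP.*-identityʳ (+ n) ⟩
  + n          ∎)
  where
  open ≡-Reasoning
  toℚᵘ-eq : mkℚᵘ (+ m) 0 ℚᵘ.≃ mkℚᵘ (+ n) 0
  toℚᵘ-eq = ℚᵘP.≃-trans (ℚᵘP.≃-sym (⟦⟧≃mkℚᵘ m))
              (ℚᵘP.≃-trans (ℚᵘP.≃-reflexive (cong toℚᵘ eq)) (⟦⟧≃mkℚᵘ n))

2^-+ : ∀ m n → 2^ (m ℕ.+ n) ≡ 2^ m * 2^ n
2^-+ m n = trans (cong ⟦_⟧ (ℕP.^-distribˡ-+-* 2 m n)) (⟦⟧-* (2 ℕ.^ m) (2 ℕ.^ n))

2^-<⇒≢ : ∀ {i n} → i < n → 2^ i ≢ 2^ n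
2^-<⇒≢ i<n eq = ℕP.<⇒≢ (ℕP.^-monoʳ-< 2 (ℕ.s≤s (ℕ.s≤s ℕ.z≤n)) i<n) (⟦⟧-injective eq)

2^≢0 : ∀ n → 2^ n ≢ 0ℚ
2^≢0 n eq = ℕP.<⇒≢ (ℕP.m^n>0 2 n) (sym (⟦⟧-injective eq))

x-y≢0 : ∀ {x y} → x ≢ y → x - y ≢ 0ℚ
x-y≢0 {x} {y} x≢y x-y≡0 = x≢y (x∙y⁻¹≈ε⇒x≈y x y x-y≡0)

*-cancelˡ-≢0 : ∀ {q x y} → q ≢ 0ℚ → q * x ≡ q * y → x ≡ y
*-cancelˡ-≢0 {q} {x} {y} q≢0 eq = begin
  x                  ≡⟨ ℚP.*-identityˡ x ⟨
  1ℚ * x             ≡⟨ cong (_* x) (ℚP.*-inverseˡ q) ⟨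
  1/ q * q * x       ≡⟨ ℚP.*-assoc (1/ q) q x ⟩
  1/ q * (q * x)     ≡⟨ cong (1/ q *_) eq ⟩
  1/ q * (q * y)     ≡⟨ ℚP.*-assoc (1/ q) q y ⟨
  1/ q * q * y       ≡⟨ cong (_* y) (ℚP.*-inverseˡ q) ⟩
  1ℚ * y             ≡⟨ ℚP.*-identityˡ y ⟩
  y                  ∎
  where
  open ≡-Reasoning
  instance _ = ≢-nonZero q≢0

*-≢0 : ∀ {p q} → p ≢ 0ℚ → q ≢ 0ℚ → p * q ≢ 0ℚ
*-≢0 {p} p≢0 q≢0 pq≡0 = q≢0 (*-cancelˡ-≢0 p≢0 (trans pq≡0 (sym (ℚP.*-zeroʳ p))))

q*[p÷'q]≡p : ∀ {p q} → q ≢ 0ℚ → q * (p ÷' q) ≡ p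
q*[p÷'q]≡p {p} {q} q≢0 with q ℚP.≟ 0ℚ
... | yes q≡0 = ⊥-elim (q≢0 q≡0)
... | no q≢0′ = begin
  q * (p * 1/ q)   ≡⟨ cong (q *_) (ℚP.*-comm p (1/ q)) ⟩
  q * (1/ q * p)   ≡⟨ ℚP.*-assoc q (1/ q) p ⟨
  q * 1/ q * p     ≡⟨ cong (_* p) (ℚP.*-inverseʳ q) ⟩
  1ℚ * p           ≡⟨ ℚP.*-identityˡ p ⟩
  p                ∎
  where
  open ≡-Reasoning
  instance _ = ≢-nonZero q≢0′

q*x≡p⇒p÷'q≡x : ∀ {p q x} → q ≢ 0ℚ → q * x ≡ p → p ÷' q ≡ x
q*x≡p⇒p÷'q≡x q≢0 eq = *-cancelˡ-≢0 q≢0 (trans (q*[p÷'q]≡p q≢0) (sym eq))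

∏-cong : ∀ k {f g : ℕ → ℚ} → (∀ i → f i ≡ g i) → ∏ k f ≡ ∏ k g
∏-cong zero    f≗g = refl
∏-cong (suc k) f≗g = cong₂ _*_ (∏-cong k f≗g) (f≗g k)

∏-distrib-* : ∀ k (f g : ℕ → ℚ) → ∏ k (λ i → f i * g i) ≡ ∏ k f * ∏ k g
∏-distrib-* zero    f g = refl
∏-distrib-* (suc k) f g = trans (cong (_* (f k * g k)) (∏-distrib-* k f g))
  (solve 4 (λ F G x y → (F :* G) :* (x :* y) := (F :* x) :* (G :* y)) refl (∏ k f) (∏ k g) (f k) (g k))
  where open ℚSolver.+-*-Solver

∏-+ : ∀ m n (f : ℕ → ℚ) → ∏ (m ℕ.+ n) f ≡ ∏ m f * ∏ n (λ i → f (m ℕ.+ i))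
∏-+ m zero    f rewrite ℕP.+-identityʳ m = sym (ℚP.*-identityʳ (∏ m f))
∏-+ m (suc n) f rewrite ℕP.+-suc m n =
  trans (cong (_* f (m ℕ.+ n)) (∏-+ m n f)) (ℚP.*-assoc (∏ m f) _ (f (m ℕ.+ n)))

∏-≢0 : ∀ k {f : ℕ → ℚ} → (∀ i → i < k → f i ≢ 0ℚ) → ∏ k f ≢ 0ℚ
∏-≢0 zero    f≢0 = ℚP.1≢0
∏-≢0 (suc k) f≢0 = *-≢0 (∏-≢0 k (λ i i<k → f≢0 i (ℕP.m<n⇒m<1+n i<k))) (f≢0 k ℕP.≤-refl)

∏-const-2^ : ∀ k t → ∏ k (λ _ → 2^ t) ≡ 2^ (t ℕ.* k)
∏-const-2^ zero    t rewrite ℕP.*-zeroʳ t = refl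
∏-const-2^ (suc k) t = begin
  ∏ k (λ _ → 2^ t) * 2^ t   ≡⟨ cong (_* 2^ t) (∏-const-2^ k t) ⟩
  2^ (t ℕ.* k) * 2^ t       ≡⟨ 2^-+ (t ℕ.* k) t ⟨
  2^ (t ℕ.* k ℕ.+ t)        ≡⟨ cong 2^ (trans (ℕP.+-comm (t ℕ.* k) t) (sym (ℕP.*-suc t k))) ⟩
  2^ (t ℕ.* suc k)          ∎
  where open ≡-Reasoning

-- the number of ordered k-tuples of linearly independent vectors in F₂ⁿ
frames : ℕ → ℕ → ℚ
frames n k = ∏ k (λ i → 2^ n - 2^ i)

frames-≢0 : ∀ {n k} → k ≤ n → frames n k ≢ 0ℚ
frames-≢0 k≤n = ∏-≢0 _ (λ i i<k → x-y≢0 (λ eq → 2^-<⇒≢ (ℕP.<-≤-trans i<k k≤n) (sym eq)))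

frames-shift : ∀ c n k → ∏ k (λ i → 2^ (c ℕ.+ n) - 2^ (c ℕ.+ i)) ≡ 2^ (c ℕ.* k) * frames n k
frames-shift c n k = begin
  ∏ k (λ i → 2^ (c ℕ.+ n) - 2^ (c ℕ.+ i))  ≡⟨ ∏-cong k factor ⟩
  ∏ k (λ i → 2^ c * (2^ n - 2^ i))        ≡⟨ ∏-distrib-* k (λ _ → 2^ c) (λ i → 2^ n - 2^ i) ⟩
  ∏ k (λ _ → 2^ c) * frames n k           ≡⟨ cong (_* frames n k) (∏-const-2^ k c) ⟩
  2^ (c ℕ.* k) * frames n k               ∎
  where
  open ≡-Reasoning
  open ℚSolver.+-*-Solver
  factor : ∀ i → 2^ (c ℕ.+ n) - 2^ (c ℕ.+ i) ≡ 2^ c * (2^ n - 2^ i)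
  factor i = trans (cong₂ _-_ (2^-+ c n) (2^-+ c i))
    (solve 3 (λ x y z → x :* y :- x :* z := x :* (y :- z)) refl (2^ c) (2^ n) (2^ i))

frames-+ : ∀ k a → frames (k ℕ.+ a) (k ℕ.+ a) ≡ frames (k ℕ.+ a) k * (2^ (k ℕ.* a) * frames a a)
frames-+ k a = trans (∏-+ k a _) (cong (frames (k ℕ.+ a) k *_) (frames-shift k a a))

gaussian : ℕ → ℕ → ℚ
gaussian k a = frames (k ℕ.+ a) k ÷' frames k k

frames*gaussian : ∀ k a → frames k k * gaussian k a ≡ frames (k ℕ.+ a) k
frames*gaussian k a = q*[p÷'q]≡p (frames-≢0 (ℕP.≤-refl {k}))

frames-+-gaussian : ∀ k a →
  frames (k ℕ.+ a) (k ℕ.+ a) ≡ 2^ (k ℕ.* a) * (frames k k * frames a a) * gaussian k a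
frames-+-gaussian k a = begin
  frames (k ℕ.+ a) (k ℕ.+ a)                              ≡⟨ frames-+ k a ⟩
  frames (k ℕ.+ a) k * (2^ (k ℕ.* a) * frames a a)
    ≡⟨ cong (_* (2^ (k ℕ.* a) * frames a a)) (frames*gaussian k a) ⟨
  frames k k * gaussian k a * (2^ (k ℕ.* a) * frames a a)
    ≡⟨ solve 4 (λ F G x H → F :* G :* (x :* H) := x :* (F :* H) :* G) refl
         (frames k k) (gaussian k a) (2^ (k ℕ.* a)) (frames a a) ⟩
  2^ (k ℕ.* a) * (frames k k * frames a a) * gaussian k a ∎
  where
  open ≡-Reasoning
  open ℚSolver.+-*-Solver

gaussian-comm : ∀ k a → gaussian k a ≡ gaussian a k
gaussian-comm k a = *-cancelˡ-≢0 c≢0 (begin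
  c * gaussian k a                                        ≡⟨ frames-+-gaussian k a ⟨
  frames (k ℕ.+ a) (k ℕ.+ a)                              ≡⟨ cong (λ n → frames n n) (ℕP.+-comm k a) ⟩
  frames (a ℕ.+ k) (a ℕ.+ k)                              ≡⟨ frames-+-gaussian a k ⟩
  2^ (a ℕ.* k) * (frames a a * frames k k) * gaussian a k
    ≡⟨ cong₂ (λ e F → 2^ e * F * gaussian a k) (ℕP.*-comm a k) (ℚP.*-comm (frames a a) (frames k k)) ⟩
  c * gaussian a k                                        ∎)
  where
  open ≡-Reasoning
  c = 2^ (k ℕ.* a) * (frames k k * frames a a)
  c≢0 : c ≢ 0ℚ
  c≢0 = *-≢0 (2^≢0 (k ℕ.* a)) (*-≢0 (frames-≢0 (ℕP.≤-refl {k})) (frames-≢0 (ℕP.≤-refl {a})))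

N1-closed : ∀ r s k → ∏ k (λ i → (2^ r - 2^ i) * 2^ s) ≡ 2^ (s ℕ.* k) * frames r k
N1-closed r s k = begin
  ∏ k (λ i → (2^ r - 2^ i) * 2^ s)  ≡⟨ ∏-distrib-* k (λ i → 2^ r - 2^ i) (λ _ → 2^ s) ⟩
  frames r k * ∏ k (λ _ → 2^ s)     ≡⟨ cong (frames r k *_) (∏-const-2^ k s) ⟩
  frames r k * 2^ (s ℕ.* k)         ≡⟨ ℚP.*-comm (frames r k) (2^ (s ℕ.* k)) ⟩
  2^ (s ℕ.* k) * frames r k         ∎
  where open ≡-Reasoning

N2-closed : ∀ s t k →
  ∏ k (λ i → (2^ (3 ℕ.* s) - 2^ (2 ℕ.* s) * 2^ i) * 2^ t) ≡ 2^ ((2 ℕ.* s ℕ.+ t) ℕ.* k) * frames s k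
N2-closed s t k = begin
  ∏ k (λ i → (2^ (3 ℕ.* s) - 2^ (2 ℕ.* s) * 2^ i) * 2^ t)
    ≡⟨ ∏-distrib-* k (λ i → 2^ (3 ℕ.* s) - 2^ (2 ℕ.* s) * 2^ i) (λ _ → 2^ t) ⟩
  ∏ k (λ i → 2^ (3 ℕ.* s) - 2^ (2 ℕ.* s) * 2^ i) * ∏ k (λ _ → 2^ t)
    ≡⟨ cong₂ _*_ (trans (∏-cong k factor) (frames-shift (2 ℕ.* s) s k)) (∏-const-2^ k t) ⟩
  2^ (2 ℕ.* s ℕ.* k) * frames s k * 2^ (t ℕ.* k)
    ≡⟨ solve 3 (λ x F y → x :* F :* y := x :* y :* F) refl
         (2^ (2 ℕ.* s ℕ.* k)) (frames s k) (2^ (t ℕ.* k)) ⟩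
  2^ (2 ℕ.* s ℕ.* k) * 2^ (t ℕ.* k) * frames s k
    ≡⟨ cong (_* frames s k) (2^-+ (2 ℕ.* s ℕ.* k) (t ℕ.* k)) ⟨
  2^ (2 ℕ.* s ℕ.* k ℕ.+ t ℕ.* k) * frames s k
    ≡⟨ cong (λ m → 2^ m * frames s k) (ℕP.*-distribʳ-+ k (2 ℕ.* s) t) ⟨
  2^ ((2 ℕ.* s ℕ.+ t) ℕ.* k) * frames s k
    ∎
  where
  open ≡-Reasoning
  open ℚSolver.+-*-Solver
  factor : ∀ i → 2^ (3 ℕ.* s) - 2^ (2 ℕ.* s) * 2^ i ≡ 2^ (2 ℕ.* s ℕ.+ s) - 2^ (2 ℕ.* s ℕ.+ i)
  factor i = cong₂ _-_ (cong 2^ (ℕP.+-comm s (2 ℕ.* s))) (sym (2^-+ (2 ℕ.* s) i))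

D1-closed : ∀ k0 k1 →
  ∏ k0 (λ i → 2^ (k0 ℕ.+ k1 ℕ.+ 0 ℕ.+ 0) - 2^ (k1 ℕ.+ 0 ℕ.+ 0 ℕ.+ i)) ≡ 2^ (k1 ℕ.* k0) * frames k0 k0
D1-closed k0 k1 = trans (∏-cong k0 factor) (frames-shift k1 k0 k0)
  where
  open ℕSolver.+-*-Solver
  factor : ∀ i → 2^ (k0 ℕ.+ k1 ℕ.+ 0 ℕ.+ 0) - 2^ (k1 ℕ.+ 0 ℕ.+ 0 ℕ.+ i) ≡ 2^ (k1 ℕ.+ k0) - 2^ (k1 ℕ.+ i)
  factor i = cong₂ (λ m n → 2^ m - 2^ n)
    (solve 2 (λ k0 k1 → k0 :+ k1 :+ con 0 :+ con 0 := k1 :+ k0) refl k0 k1)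
    (solve 2 (λ k1 i → k1 :+ con 0 :+ con 0 :+ i := k1 :+ i) refl k1 i)

D2-closed : ∀ k0 k1 →
  ∏ k1 (λ i → (2^ (3 ℕ.* k1) - 2^ (2 ℕ.* k1) * 2^ i) * 2^ (k0 ℕ.+ 2 ℕ.* 0 ℕ.+ 0))
    ≡ 2^ ((2 ℕ.* k1 ℕ.+ k0) ℕ.* k1) * frames k1 k1
D2-closed k0 k1 = trans
  (cong (λ t → ∏ k1 (λ i → (2^ (3 ℕ.* k1) - 2^ (2 ℕ.* k1) * 2^ i) * 2^ t))
        (trans (ℕP.+-identityʳ (k0 ℕ.+ 0)) (ℕP.+-identityʳ k0)))
  (N2-closed k1 k0 k1)

-- The factors 1ℚ are the empty products N3, N4 (resp. D3, D4) at k2 = k3 = 0.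
collect-2^ : ∀ {A B F G} x y → A ≡ 2^ x * F → B ≡ 2^ y * G → A * B * 1ℚ * 1ℚ ≡ 2^ (x ℕ.+ y) * (F * G)
collect-2^ {F = F} {G} x y refl refl = begin
  2^ x * F * (2^ y * G) * 1ℚ * 1ℚ
    ≡⟨ solve 4 (λ a F b G → a :* F :* (b :* G) :* con 1ℚ :* con 1ℚ := a :* b :* (F :* G))
         refl (2^ x) F (2^ y) G ⟩
  2^ x * 2^ y * (F * G)           ≡⟨ cong (_* (F * G)) (2^-+ x y) ⟨
  2^ (x ℕ.+ y) * (F * G)          ∎
  where
  open ≡-Reasoning
  open ℚSolver.+-*-Solver

N2x8-as-quotient : ∀ r s k0 k1 → N2x8 r s k0 k1 0 0 ≡
  (2^ (s ℕ.* k0 ℕ.+ (2 ℕ.* s ℕ.+ r) ℕ.* k1) * (frames r k0 * frames s k1))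
    ÷' (2^ (k1 ℕ.* k0 ℕ.+ (2 ℕ.* k1 ℕ.+ k0) ℕ.* k1) * (frames k0 k0 * frames k1 k1))
N2x8-as-quotient r s k0 k1 = cong₂ _÷'_
  (collect-2^ (s ℕ.* k0) ((2 ℕ.* s ℕ.+ r) ℕ.* k1) (N1-closed r s k0) (N2-closed s r k1))
  (collect-2^ (k1 ℕ.* k0) ((2 ℕ.* k1 ℕ.+ k0) ℕ.* k1) (D1-closed k0 k1) (D2-closed k0 k1))

N2x8-closed : ∀ k0 a k1 b → N2x8 (k0 ℕ.+ a) (k1 ℕ.+ b) k0 k1 0 0
  ≡ 2^ (b ℕ.* k0 ℕ.+ 2 ℕ.* b ℕ.* k1 ℕ.+ a ℕ.* k1) * (gaussian k0 a * gaussian k1 b)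
N2x8-closed k0 a k1 b =
  trans (N2x8-as-quotient r s k0 k1) (q*x≡p⇒p÷'q≡x denominator≢0 cross-multiplied)
  where
  r = k0 ℕ.+ a
  s = k1 ℕ.+ b
  d = k1 ℕ.* k0 ℕ.+ (2 ℕ.* k1 ℕ.+ k0) ℕ.* k1
  e = b ℕ.* k0 ℕ.+ 2 ℕ.* b ℕ.* k1 ℕ.+ a ℕ.* k1
  n = s ℕ.* k0 ℕ.+ (2 ℕ.* s ℕ.+ r) ℕ.* k1

  denominator≢0 : 2^ d * (frames k0 k0 * frames k1 k1) ≢ 0ℚ
  denominator≢0 = *-≢0 (2^≢0 d) (*-≢0 (frames-≢0 (ℕP.≤-refl {k0})) (frames-≢0 (ℕP.≤-refl {k1})))

  d+e≡n : d ℕ.+ e ≡ n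
  d+e≡n = solve 4 (λ k0 a k1 b →
      k1 :* k0 :+ (con 2 :* k1 :+ k0) :* k1 :+ (b :* k0 :+ con 2 :* b :* k1 :+ a :* k1)
    := (k1 :+ b) :* k0 :+ (con 2 :* (k1 :+ b) :+ (k0 :+ a)) :* k1) refl k0 a k1 b
    where open ℕSolver.+-*-Solver

  cross-multiplied : 2^ d * (frames k0 k0 * frames k1 k1) * (2^ e * (gaussian k0 a * gaussian k1 b))
                     ≡ 2^ n * (frames r k0 * frames s k1)
  cross-multiplied = begin
    2^ d * (frames k0 k0 * frames k1 k1) * (2^ e * (gaussian k0 a * gaussian k1 b))
      ≡⟨ solve 6 (λ x F₀ F₁ y G₀ G₁ →
                    x :* (F₀ :* F₁) :* (y :* (G₀ :* G₁)) := x :* y :* (F₀ :* G₀ :* (F₁ :* G₁)))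
           refl (2^ d) (frames k0 k0) (frames k1 k1) (2^ e) (gaussian k0 a) (gaussian k1 b) ⟩
    2^ d * 2^ e * (frames k0 k0 * gaussian k0 a * (frames k1 k1 * gaussian k1 b))
      ≡⟨ cong₂ _*_ (sym (2^-+ d e)) (cong₂ _*_ (frames*gaussian k0 a) (frames*gaussian k1 b)) ⟩
    2^ (d ℕ.+ e) * (frames r k0 * frames s k1)
      ≡⟨ cong (λ m → 2^ m * (frames r k0 * frames s k1)) d+e≡n ⟩
    2^ n * (frames r k0 * frames s k1)
      ∎
    where
    open ≡-Reasoning
    open ℚSolver.+-*-Solver

N2x8-dual : ∀ k0 a k1 b → N2x8 (k0 ℕ.+ a) (k1 ℕ.+ b) k0 k1 0 0 ≡ N2x8 (k0 ℕ.+ a) (k1 ℕ.+ b) a b 0 0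
N2x8-dual k0 a k1 b = begin
  N2x8 (k0 ℕ.+ a) (k1 ℕ.+ b) k0 k1 0 0
    ≡⟨ N2x8-closed k0 a k1 b ⟩
  2^ (b ℕ.* k0 ℕ.+ 2 ℕ.* b ℕ.* k1 ℕ.+ a ℕ.* k1) * (gaussian k0 a * gaussian k1 b)
    ≡⟨ cong₂ (λ m g → 2^ m * g) exponent-symmetric
             (cong₂ _*_ (gaussian-comm k0 a) (gaussian-comm k1 b)) ⟩
  2^ (k1 ℕ.* a ℕ.+ 2 ℕ.* k1 ℕ.* b ℕ.+ k0 ℕ.* b) * (gaussian a k0 * gaussian b k1)
    ≡⟨ N2x8-closed a k0 b k1 ⟨
  N2x8 (a ℕ.+ k0) (b ℕ.+ k1) a b 0 0
    ≡⟨ cong₂ (λ r s → N2x8 r s a b 0 0) (ℕP.+-comm a k0) (ℕP.+-comm b k1) ⟩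
  N2x8 (k0 ℕ.+ a) (k1 ℕ.+ b) a b 0 0
    ∎
  where
  open ≡-Reasoning
  exponent-symmetric : b ℕ.* k0 ℕ.+ 2 ℕ.* b ℕ.* k1 ℕ.+ a ℕ.* k1 ≡ k1 ℕ.* a ℕ.+ 2 ℕ.* k1 ℕ.* b ℕ.+ k0 ℕ.* b
  exponent-symmetric = solve 4 (λ k0 a k1 b →
      b :* k0 :+ con 2 :* b :* k1 :+ a :* k1 := k1 :* a :+ con 2 :* k1 :* b :+ k0 :* b) refl k0 a k1 b
    where open ℕSolver.+-*-Solver

corollary3 : (r s k0 k1 : ℕ) → k0 ≤ r → k1 ≤ s →
    N2x8 r s k0 k1 0 0 ≡ N2x8 r s (r ∸ k0) (s ∸ k1) 0 0
corollary3 r s k0 k1 k0≤r k1≤s =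
  subst₂ (λ r′ s′ → N2x8 r′ s′ k0 k1 0 0 ≡ N2x8 r′ s′ (r ∸ k0) (s ∸ k1) 0 0)
         (ℕP.m+[n∸m]≡n k0≤r) (ℕP.m+[n∸m]≡n k1≤s)
         (N2x8-dual k0 (r ∸ k0) k1 (s ∸ k1))
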